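{- Every clique in $\Gamma_{\{ -1,0\}}$ of size greater than $10$ contains four vertices that are pairwise orthogonal (a subclique of size $4$ all of whose edges have color $0$).
   Context: $\Lambda=\{a\in \mathbb{Z}^8+\langle(\tfrac12,\ldots,\tfrac12)\rangle : \sum_i a_i\in 2\mathbb{Z}\}$ is the $E_8$ lattice and $E=\{a\in\Lambda:\|a\|=\sqrt2\}$. $\Gamma_{\{ -1,0\}}$ is the graph on $E$ whose edges join roots with dot product $-1$ or $0$ (edge color = dot product); a clique is a set of roots with all pairwise dot products in $\{ -1,0\}$, and its size is its number of vertices. -}

module Defs where

open import Data.Nat using (ℕ)
open import Data.Integer using (ℤ; +_; -[1+_]; _*_; _+_)
open import Data.Integer.Divisibility using (_∣_)
open import Data.Vec using (Vec; foldr; zipWith)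
open import Data.Vec.Relation.Unary.All using (All)
open import Data.List using (List)
open import Data.List.Relation.Unary.All using () renaming (All to AllL)
open import Data.List.Relation.Unary.AllPairs using (AllPairs)
open import Data.Product using (_×_)
open import Data.Sum using (_⊎_)
open import Relation.Binary.PropositionalEquality using (_≡_)
open import Relation.Nullary using (¬_)

-- Convention: a vector a ∈ ℚ^8 with coordinates in ½ℤ is represented by its
-- DOUBLE v = 2a ∈ ℤ^8.  So a ∈ ℤ^8 ∪ (ℤ^8 + (½,…,½)) iff all v_i are even or
-- all v_i are odd, and Σ a_i ∈ 2ℤ iff 4 ∣ Σ v_i.

V8 : Set
V8 = Vec ℤ 8

sumℤ : ∀ {n} → Vec ℤ n → ℤ
sumℤ = foldr _ _+_ (+ 0)

-- dot2 (2a) (2b) = Σ 4 a_i b_i = 4 ⟨a , b⟩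
dot2 : V8 → V8 → ℤ
dot2 u v = sumℤ (zipWith _*_ u v)

Even : ℤ → Set
Even x = + 2 ∣ x

Odd : ℤ → Set
Odd x = ¬ (+ 2 ∣ x)

InE8 : V8 → Set
InE8 v = (All Even v ⊎ All Odd v) × (+ 4 ∣ sumℤ v)

IsRoot : V8 → Set
IsRoot v = InE8 v × dot2 v v ≡ + 8

Adj : V8 → V8 → Set
Adj u v = dot2 u v ≡ -[1+ 3 ] ⊎ dot2 u v ≡ + 0

Orth : V8 → V8 → Set
Orth u v = dot2 u v ≡ + 0

-- a clique of Γ_{-1,0}: a list of roots, pairwise (at distinct positions)
-- with dot product -1 or 0.  (Such a list automatically has no repeats,
-- since ⟨a,a⟩ = 2.)  Its size is its length.
IsClique : List V8 → Set
IsClique C = AllL IsRoot C × AllPairs Adj C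

module Submission where

-- If three vectors v, a, b of norm 2 have pairwise inner
-- products -1, then ‖v + a + b‖² = 6 - 6 = 0, so v + a + b = 0 and every c
-- satisfies c·v + c·a + c·b = 0.  Hence, if a, b, c are mutually adjacent
-- clique members all at inner product -1 with a fixed v, then a ⟂ b (else
-- c·a + c·b = 1 with both summands in {-1, 0}).  So as soon as the
-- "negative neighbourhood" of a clique vertex has three members, it is a
-- pairwise orthogonal set.
--
-- Split the rest of a clique at its first vertex v
-- into neighbours at inner product -1 and neighbours orthogonal to v.
-- Either the first part is large (and orthogonal by the above), or the
-- second part is large and we recurse inside it and add v.  This gives
-- pairwise orthogonal sets of size k + 1 in every clique of size
-- threshold k, where threshold 0, 1, 2, 3 = 1, 4, 7, 11; the theorem is the
-- case k = 3.

open import Defs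
open import Function using (_∘_; id)
open import Data.Nat as ℕ using (ℕ; zero; suc; _≤_; _⊔_; s≤s; z≤n)
import Data.Nat.Properties as ℕP
open import Data.Integer using (ℤ; +_; -[1+_]; _*_; _+_; ∣_∣) renaming (_≟_ to _≟ℤ_)
import Data.Integer.Properties as ℤP
open import Data.Integer.Tactic.RingSolver using (solve-∀)
open import Data.Vec using (Vec; []; _∷_; zipWith; replicate)
open import Data.List using (List; []; _∷_; length; filter)
open import Data.List.Membership.Propositional using (_∈_)
open import Data.List.Relation.Binary.Subset.Propositional using (_⊆_)
open import Data.List.Relation.Binary.Subset.Propositional.Properties using (filter-⊆; All-resp-⊇)
open import Data.List.Relation.Unary.Any using (here; there)
open import Data.List.Relation.Unary.All as All using (All; []; _∷_)
import Data.List.Relation.Unary.All.Properties as AllP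
open import Data.List.Relation.Unary.AllPairs using (AllPairs; []; _∷_)
import Data.List.Relation.Unary.AllPairs.Properties as AllPairsP
open import Data.Product using (_×_; _,_; proj₂; ∃-syntax)
open import Data.Sum using (_⊎_; inj₁; inj₂; [_,_]′)
open import Data.Empty using (⊥-elim)
open import Relation.Nullary using (¬_; yes; no)
open import Relation.Unary using (Pred; Decidable)
open import Relation.Unary.Properties using (∁?)
open import Relation.Binary.PropositionalEquality
open ≡-Reasoning

-- The standard inner product on ℤⁿ; for n = 8 it is definitionally dot2.
dot : ∀ {n} → Vec ℤ n → Vec ℤ n → ℤ
dot u v = sumℤ (zipWith _*_ u v)

infixl 6 _⊕_
_⊕_ : ∀ {n} → Vec ℤ n → Vec ℤ n → Vec ℤ n
_⊕_ = zipWith _+_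

dot-comm : ∀ {n} (u v : Vec ℤ n) → dot u v ≡ dot v u
dot-comm []       []       = refl
dot-comm (x ∷ xs) (y ∷ ys) = cong₂ _+_ (ℤP.*-comm x y) (dot-comm xs ys)

dot-distribʳ : ∀ {n} (u v w : Vec ℤ n) → dot u (v ⊕ w) ≡ dot u v + dot u w
dot-distribʳ []       []       []       = refl
dot-distribʳ (x ∷ xs) (y ∷ ys) (z ∷ zs) = begin
  x * (y + z) + dot xs (ys ⊕ zs)            ≡⟨ cong (_+_ (x * (y + z))) (dot-distribʳ xs ys zs) ⟩
  x * (y + z) + (dot xs ys + dot xs zs)     ≡⟨ regroup x y z (dot xs ys) (dot xs zs) ⟩
  x * y + dot xs ys + (x * z + dot xs zs)   ∎
  where
  regroup : ∀ x y z p q → x * (y + z) + (p + q) ≡ x * y + p + (x * z + q)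
  regroup = solve-∀

dot-distribˡ : ∀ {n} (u v w : Vec ℤ n) → dot (u ⊕ v) w ≡ dot u w + dot v w
dot-distribˡ u v w = begin
  dot (u ⊕ v) w        ≡⟨ dot-comm (u ⊕ v) w ⟩
  dot w (u ⊕ v)        ≡⟨ dot-distribʳ w u v ⟩
  dot w u + dot w v    ≡⟨ cong₂ _+_ (dot-comm w u) (dot-comm w v) ⟩
  dot u w + dot v w    ∎

norm-⊕ : ∀ {n} (u v : Vec ℤ n) → dot (u ⊕ v) (u ⊕ v) ≡ dot u u + dot v v + + 2 * dot u v
norm-⊕ u v = begin
  dot (u ⊕ v) (u ⊕ v)                            ≡⟨ dot-distribˡ u v (u ⊕ v) ⟩
  dot u (u ⊕ v) + dot v (u ⊕ v)                  ≡⟨ cong₂ _+_ (dot-distribʳ u u v) (dot-distribʳ v u v) ⟩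
  dot u u + dot u v + (dot v u + dot v v)        ≡⟨ cong (λ t → dot u u + dot u v + (t + dot v v)) (dot-comm v u) ⟩
  dot u u + dot u v + (dot u v + dot v v)        ≡⟨ collect (dot u u) (dot u v) (dot v v) ⟩
  dot u u + dot v v + + 2 * dot u v              ∎
  where
  collect : ∀ p q r → p + q + (q + r) ≡ p + r + + 2 * q
  collect = solve-∀

sumOfSquares : ∀ {n} → Vec ℤ n → ℕ
sumOfSquares []       = 0
sumOfSquares (x ∷ xs) = ∣ x ∣ ℕ.* ∣ x ∣ ℕ.+ sumOfSquares xs

square≡ : ∀ x → x * x ≡ + (∣ x ∣ ℕ.* ∣ x ∣)
square≡ (+ zero)    = refl
square≡ (+ suc _)   = refl
square≡ -[1+ _ ]    = refl

norm≡sumOfSquares : ∀ {n} (w : Vec ℤ n) → dot w w ≡ + sumOfSquares w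
norm≡sumOfSquares []       = refl
norm≡sumOfSquares (x ∷ xs) = cong₂ _+_ (square≡ x) (norm≡sumOfSquares xs)

norm-zero : ∀ {n} (w : Vec ℤ n) → dot w w ≡ + 0 → w ≡ replicate n (+ 0)
norm-zero w ww≡0 = squares-zero w (ℤP.+-injective (trans (sym (norm≡sumOfSquares w)) ww≡0))
  where
  square-zero : ∀ m → m ℕ.* m ≡ 0 → m ≡ 0
  square-zero m = [ id , id ]′ ∘ ℕP.m*n≡0⇒m≡0∨n≡0 m

  squares-zero : ∀ {n} (w : Vec ℤ n) → sumOfSquares w ≡ 0 → w ≡ replicate n (+ 0)
  squares-zero []       _  = refl
  squares-zero (x ∷ xs) eq = cong₂ _∷_
    (ℤP.∣i∣≡0⇒i≡0 (square-zero ∣ x ∣ (ℕP.m+n≡0⇒m≡0 (∣ x ∣ ℕ.* ∣ x ∣) eq)))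
    (squares-zero xs (ℕP.m+n≡0⇒n≡0 (∣ x ∣ ℕ.* ∣ x ∣) eq))

dot-zeroʳ : ∀ {n} (u : Vec ℤ n) → dot u (replicate n (+ 0)) ≡ + 0
dot-zeroʳ []       = refl
dot-zeroʳ (x ∷ xs) = cong₂ _+_ (ℤP.*-zeroʳ x) (dot-zeroʳ xs)

-- Three vectors of norm 2 with pairwise inner products -1 (doubled: 8 and
-- -4) sum to zero, since ‖v + a + b‖² = 3·2 + 2·3·(-1) = 0.
obtuse-triangle-sum : ∀ {n} {v a b : Vec ℤ n} →
  dot v v ≡ + 8 → dot a a ≡ + 8 → dot b b ≡ + 8 →
  dot v a ≡ -[1+ 3 ] → dot v b ≡ -[1+ 3 ] → dot a b ≡ -[1+ 3 ] →
  v ⊕ a ⊕ b ≡ replicate n (+ 0)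
obtuse-triangle-sum {v = v} {a} {b} vv aa bb va vb ab = norm-zero (v ⊕ a ⊕ b) (begin
  dot (v ⊕ a ⊕ b) (v ⊕ a ⊕ b)
    ≡⟨ norm-⊕ (v ⊕ a) b ⟩
  dot (v ⊕ a) (v ⊕ a) + dot b b + + 2 * dot (v ⊕ a) b
    ≡⟨ cong₂ (λ p q → p + dot b b + + 2 * q) (norm-⊕ v a) (dot-distribˡ v a b) ⟩
  dot v v + dot a a + + 2 * dot v a + dot b b + + 2 * (dot v b + dot a b)
    ≡⟨ cong₂ _+_ (cong₂ _+_ (cong₂ _+_ (cong₂ _+_ vv aa) (cong (+ 2 *_) va)) bb)
                 (cong (+ 2 *_) (cong₂ _+_ vb ab)) ⟩
  + 0 ∎)

obtuse-triangle-dot : ∀ {n} {v a b : Vec ℤ n} →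
  dot v v ≡ + 8 → dot a a ≡ + 8 → dot b b ≡ + 8 →
  dot v a ≡ -[1+ 3 ] → dot v b ≡ -[1+ 3 ] → dot a b ≡ -[1+ 3 ] →
  ∀ c → dot c v + dot c a + dot c b ≡ + 0
obtuse-triangle-dot {n} {v} {a} {b} vv aa bb va vb ab c = begin
  dot c v + dot c a + dot c b   ≡⟨ cong (_+ dot c b) (dot-distribʳ c v a) ⟨
  dot c (v ⊕ a) + dot c b       ≡⟨ dot-distribʳ c (v ⊕ a) b ⟨
  dot c (v ⊕ a ⊕ b)             ≡⟨ cong (dot c) (obtuse-triangle-sum vv aa bb va vb ab) ⟩
  dot c (replicate n (+ 0))     ≡⟨ dot-zeroʳ c ⟩
  + 0                           ∎

HasNorm2 : V8 → Set
HasNorm2 x = dot2 x x ≡ + 8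

-- A clique of Γ_{-1,0} among vectors of norm 2.
NormTwoClique : List V8 → Set
NormTwoClique C = All HasNorm2 C × AllPairs Adj C

Obtuse : V8 → V8 → Set
Obtuse v x = dot2 v x ≡ -[1+ 3 ]

NegNeighbour : V8 → V8 → Set
NegNeighbour v x = HasNorm2 x × Obtuse v x

Adj-sym : ∀ u v → Adj u v → Adj v u
Adj-sym u v (inj₁ uv) = inj₁ (trans (dot-comm v u) uv)
Adj-sym u v (inj₂ uv) = inj₂ (trans (dot-comm v u) uv)

unbalanced : ∀ {x y : ℤ} → x ≡ -[1+ 3 ] ⊎ x ≡ + 0 → y ≡ -[1+ 3 ] ⊎ y ≡ + 0 →
  ¬ (-[1+ 3 ] + x + y ≡ + 0)
unbalanced (inj₁ refl) (inj₁ refl) ()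
unbalanced (inj₁ refl) (inj₂ refl) ()
unbalanced (inj₂ refl) (inj₁ refl) ()
unbalanced (inj₂ refl) (inj₂ refl) ()

module NegativeNeighbourhood {v : V8} (v-norm : HasNorm2 v) where

  -- Three mutually adjacent negative neighbours: a ⟂ b.  Otherwise v, a, b
  -- is an obtuse triangle, so c·v + c·a + c·b = 0 with c·v = -1, which
  -- `unbalanced` rules out.
  third-forces-orth : ∀ {a b c} → NegNeighbour v a → NegNeighbour v b → NegNeighbour v c →
    Adj a b → Adj a c → Adj b c → Orth a b
  third-forces-orth _ _ _ (inj₂ a⊥b) _ _ = a⊥b
  third-forces-orth {a} {b} {c} (a-norm , va) (b-norm , vb) (_ , vc) (inj₁ ab) ac bc =
    ⊥-elim (unbalanced (Adj-sym a c ac) (Adj-sym b c bc) balanced)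
    where
    balanced : -[1+ 3 ] + dot c a + dot c b ≡ + 0
    balanced = subst (λ t → t + dot c a + dot c b ≡ + 0) (trans (dot-comm c v) vc)
      (obtuse-triangle-dot v-norm a-norm b-norm va vb ab c)

  orth-to-all : ∀ {x c ws} → NegNeighbour v x → NegNeighbour v c → Adj x c →
    All (NegNeighbour v) ws → All (Adj x) ws → All (Adj c) ws → All (Orth x) ws
  orth-to-all _ _ _ [] [] [] = []
  orth-to-all {x} {c} {w ∷ _} nx nc xc (nw ∷ nws) (xw ∷ xws) (cw ∷ cws) =
    third-forces-orth nx nw nc xw xc (Adj-sym c w cw) ∷ orth-to-all nx nc xc nws xws cws

  orth-with-witness : ∀ {c ys} → NegNeighbour v c → All (Adj c) ys →
    All (NegNeighbour v) ys → AllPairs Adj ys → AllPairs Orth ys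
  orth-with-witness _ [] [] [] = []
  orth-with-witness {c} {x ∷ _} nc (cx ∷ cxs) (nx ∷ nxs) (xxs ∷ adj) =
    orth-to-all nx nc (Adj-sym c x cx) nxs xxs cxs ∷ orth-with-witness nc cxs nxs adj

  -- Three or more negative neighbours forming a clique are pairwise
  -- orthogonal: the pair (x, y) is witnessed by z, the pairs (x, w) by y and
  -- all pairs avoiding x by x.
  neighbours-orth : ∀ ns → 3 ≤ length ns → All (NegNeighbour v) ns → AllPairs Adj ns →
    AllPairs Orth ns
  neighbours-orth (x ∷ y ∷ z ∷ zs) (s≤s (s≤s (s≤s _))) (nx ∷ ny ∷ nz ∷ nzs)
    ((xy ∷ xz ∷ xzs) ∷ (yz ∷ yzs) ∷ adj) =
    (third-forces-orth nx ny nz xy xz yz ∷ orth-to-all nx ny xy (nz ∷ nzs) (xz ∷ xzs) (yz ∷ yzs))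
    ∷ orth-with-witness nx (xy ∷ xz ∷ xzs) (ny ∷ nz ∷ nzs) ((yz ∷ yzs) ∷ adj)

length-filter-complement : ∀ {a p} {A : Set a} {P : Pred A p} (P? : Decidable P) (xs : List A) →
  length (filter P? xs) ℕ.+ length (filter (∁? P?) xs) ≡ length xs
length-filter-complement P? []       = refl
length-filter-complement P? (x ∷ xs) with P? x
... | yes _ = cong suc (length-filter-complement P? xs)
... | no _  = trans (ℕP.+-suc _ _) (cong suc (length-filter-complement P? xs))

obtuse? : (v : V8) → Decidable (Obtuse v)
obtuse? v x = dot2 v x ≟ℤ -[1+ 3 ]

negPart orthPart : V8 → List V8 → List V8
negPart v  = filter (obtuse? v)
orthPart v = filter (∁? (obtuse? v))

negPart-neighbours : ∀ v {xs} → All HasNorm2 xs → All (NegNeighbour v) (negPart v xs)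
negPart-neighbours v {xs} norms = All.zip (AllP.filter⁺ (obtuse? v) norms , AllP.all-filter (obtuse? v) xs)

orthPart-orth : ∀ v {xs} → All (Adj v) xs → All (Orth v) (orthPart v xs)
orthPart-orth v {xs} adj =
  All.zipWith orth-unless-obtuse (AllP.filter⁺ (∁? (obtuse? v)) adj , AllP.all-filter (∁? (obtuse? v)) xs)
  where
  orth-unless-obtuse : ∀ {x} → Adj v x × ¬ Obtuse v x → Orth v x
  orth-unless-obtuse (inj₁ obtuse , not-obtuse) = ⊥-elim (not-obtuse obtuse)
  orth-unless-obtuse (inj₂ orth   , _)          = orth

clique-filter : ∀ {p} {P : Pred V8 p} (P? : Decidable P) {C} → NormTwoClique C → NormTwoClique (filter P? C)
clique-filter P? (norms , adj) = AllP.filter⁺ P? norms , AllPairsP.filter⁺ P? adj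

pigeonhole : ∀ {m k a b} → m ℕ.+ k ≤ a ℕ.+ b → a ≤ k → m ≤ b
pigeonhole {m} {k} {a} {b} m+k≤a+b a≤k =
  ℕP.+-cancelʳ-≤ k m b (ℕP.≤-trans m+k≤a+b a+b≤b+k)
  where
  a+b≤b+k : a ℕ.+ b ≤ b ℕ.+ k
  a+b≤b+k = subst (a ℕ.+ b ≤_) (ℕP.+-comm k b) (ℕP.+-monoˡ-≤ b a≤k)

record OrthogonalSubset (k : ℕ) (C : List V8) : Set where
  constructor orthogonal-subset
  field
    members       : List V8
    members⊆C     : members ⊆ C
    large         : k ≤ length members
    pairwise-orth : AllPairs Orth members

-- threshold k is the clique size guaranteeing k + 1 pairwise orthogonal
-- members: 1, 4, 7, 11, 15, …  The second summand is one less than the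
-- number of negative neighbours that suffice in the recursion step.
threshold : ℕ → ℕ
threshold zero    = 1
threshold (suc k) = suc (threshold k ℕ.+ (2 ⊔ suc k))

-- Either at least max(3, k + 2) neighbours of the first vertex v are at
-- inner product -1 (then they form the subset), or at least threshold k are
-- orthogonal to v (then recurse among them and add v).
orthogonal-subset-exists : ∀ k C → NormTwoClique C → threshold k ≤ length C →
  OrthogonalSubset (suc k) C
orthogonal-subset-exists zero (v ∷ _) _ _ =
  orthogonal-subset (v ∷ []) (λ { (here refl) → here refl }) (s≤s z≤n) ([] ∷ [])
orthogonal-subset-exists (suc k) (v ∷ rest) (v-norm ∷ norms , v-adj ∷ adj) (s≤s size)
  with suc (2 ⊔ suc k) ℕP.≤? length (negPart v rest)
... | yes many =
  orthogonal-subset (negPart v rest) (there ∘ filter-⊆ (obtuse? v) rest)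
    (ℕP.≤-trans (s≤s (ℕP.m≤n⊔m 2 (suc k))) many)
    (neighbours-orth (negPart v rest) (ℕP.≤-trans (s≤s (ℕP.m≤m⊔n 2 (suc k))) many)
      (negPart-neighbours v norms) (AllPairsP.filter⁺ (obtuse? v) adj))
  where open NegativeNeighbourhood {v} v-norm
... | no few
  with orthogonal-subset-exists k (orthPart v rest) (clique-filter (∁? (obtuse? v)) (norms , adj))
         (pigeonhole (subst (_ ≤_) (sym (length-filter-complement (obtuse? v) rest)) size) (ℕP.≮⇒≥ few))
... | orthogonal-subset S S⊆orthPart large orth =
  orthogonal-subset (v ∷ S) S+v⊆C (s≤s large)
    (All-resp-⊇ S⊆orthPart (orthPart-orth v v-adj) ∷ orth)
  where
  S+v⊆C : v ∷ S ⊆ v ∷ rest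
  S+v⊆C (here refl) = here refl
  S+v⊆C (there x∈S) = there (filter-⊆ (∁? (obtuse? v)) rest (S⊆orthPart x∈S))

proposition5p20 : (C : List V8) → IsClique C → 10 ℕ.< length C →
  ∃[ a ] ∃[ b ] ∃[ c ] ∃[ d ] (a ∈ C × b ∈ C × c ∈ C × d ∈ C ×
    Orth a b × Orth a c × Orth a d × Orth b c × Orth b d × Orth c d)
proposition5p20 C (roots , adj) more-than-ten
  with orthogonal-subset-exists 3 C (All.map proj₂ roots , adj) more-than-ten
... | orthogonal-subset (a ∷ b ∷ c ∷ d ∷ _) ⊆C (s≤s (s≤s (s≤s (s≤s _))))
        ((ab ∷ ac ∷ ad ∷ _) ∷ (bc ∷ bd ∷ _) ∷ (cd ∷ _) ∷ _) =
  a , b , c , d ,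
  ⊆C (here refl) , ⊆C (there (here refl)) , ⊆C (there (there (here refl))) ,
  ⊆C (there (there (there (here refl)))) ,
  ab , ac , ad , bc , bd , cd
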